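{- For every integer $k\ge 2$, $\alpha(k)\ge 1/k$.
   Context: A Boolean circuit is a directed acyclic graph with input nodes $x_1,\dots,x_n$ and internal gates of in-degree 2, each labeled by an arbitrary binary Boolean function, with one output gate; its size is its number of internal gates. A $k$-CNF is a conjunction of clauses each having at most $k$ literals. For an integer $k\ge 2$, $\alpha(k)$ is defined as the infimum of all $\alpha$ such that (for every $n$) every circuit of size $s$ computes a function that can be written as an OR of at most $2^{\alpha s}$ $k$-CNFs. -}

module Defs where

open import Data.Nat using (ℕ; suc; _≤_; _^_; _*_)
open import Data.Bool using (Bool; true; false; _∧_; _∨_; if_then_else_; not)
open import Data.Fin using (Fin)
open import Data.Sum using (_⊎_; inj₁; inj₂)
open import Data.Product using (Σ; _×_; _,_)
open import Data.List using (List; length)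
open import Data.Bool.ListAction using (any; all)
open import Relation.Binary.PropositionalEquality using (_≡_)
open import Data.List.Relation.Unary.All using (All)
open import Data.Vec using (Vec; []; _∷ʳ_; lookup)

Input : ℕ → Set
Input n = Fin n → Bool

-- A gate added after s earlier gates: each of its two in-wires is either an
-- input variable (inj₁) or one of the s earlier gates (inj₂), and it is
-- labelled by an arbitrary binary Boolean function.  Indexing wires only to
-- earlier gates encodes acyclicity (a topological order of the DAG).
Gate : ℕ → ℕ → Set
Gate n s = (Fin n ⊎ Fin s) × (Fin n ⊎ Fin s) × (Bool → Bool → Bool)

data Circuit (n : ℕ) : ℕ → Set where
  []  : Circuit n 0
  _▷_ : ∀ {s} → Circuit n s → Gate n s → Circuit n (suc s)

gateValues : ∀ {n s} → Circuit n s → Input n → Vec Bool s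
gateValues [] x = []
gateValues (C ▷ (a , b , f)) x = v ∷ʳ f (wire a) (wire b)
  where
  v = gateValues C x
  wire : _ → Bool
  wire (inj₁ i) = x i
  wire (inj₂ j) = lookup v j

computes : ∀ {n s} → Circuit n s → Fin s → Input n → Bool
computes C o x = lookup (gateValues C x) o

-- Literals: a variable with a polarity (true = positive literal x_i,
-- false = negated literal ¬x_i).
Literal : ℕ → Set
Literal n = Fin n × Bool

Clause : ℕ → Set
Clause n = List (Literal n)

CNF : ℕ → Set
CNF n = List (Clause n)

evalLit : ∀ {n} → Input n → Literal n → Bool
evalLit x (i , true)  = x i
evalLit x (i , false) = not (x i)

evalClause : ∀ {n} → Input n → Clause n → Bool
evalClause x c = any (evalLit x) c

evalCNF : ∀ {n} → Input n → CNF n → Bool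
evalCNF x φ = all (evalClause x) φ

evalOrCNF : ∀ {n} → Input n → List (CNF n) → Bool
evalOrCNF x Φ = any (evalCNF x) Φ

IsKCNF : ∀ {n} → ℕ → CNF n → Set
IsKCNF k φ = All (λ c → length c ≤ k) φ

-- α = p / q belongs to the set whose infimum is α(k): every circuit of size s
-- computes a function that is an OR of t ≤ 2^{α s} k-CNFs
-- (t ≤ 2^{ps/q} ⇔ t^q ≤ 2^{ps}, since t, 2^{ps/q} ≥ 0).
Admissible : ℕ → ℕ → ℕ → Set
Admissible k p q =
  ∀ (n s : ℕ) (C : Circuit n s) (o : Fin s) →
  Σ (List (CNF n)) λ Φ →
    (length Φ ^ q ≤ 2 ^ (p * s)) × All (IsKCNF k) Φ × (∀ x → computes C o x ≡ evalOrCNF x Φ)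

-- Parity of n = k m bits is computed by n − 1 xor gates, but every OR of k-CNFs computing it has at
-- least 2 ^ (m − 1) terms; for circuit size s = n − 1 this is 2 ^ ((s + 1) / k − 1), which eventually
-- exceeds 2 ^ (α s) whenever α < 1 / k.
--
-- The lower bound is the Paturi–Pudlák–Zane argument.  A k-CNF F below parity has isolated solutions,
-- so for a solution x and a variable i some clause of F is falsified by flipping x at i; among the
-- solutions of F, the value at i is determined by the at most k − 1 other variables of that clause.
-- Deleting the variables in a random order, i is forced (all those variables go before it) with
-- probability at least 1 / k, so by convexity E[2 ^ #forced] ≥ 2 ^ m, while an encoding argument gives
-- Σ_x E[2 ^ #forced] ≤ 2 ^ n.  So F has at most 2 ^ (n − m) solutions, and parity has 2 ^ (n − 1).

module Submission where

open import Defs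
open import Data.Nat using (ℕ; zero; suc; _+_; _*_; _∸_; _^_; _≤_; _<_; z≤n; s≤s; _!; >-nonZero)
open import Data.Nat.Properties hiding (_≟_)
open import Data.Nat.Tactic.RingSolver using (solve-∀)
open import Data.Nat.DivMod using (_/_; m*[n/m]≡n; n/1≡n; /-monoʳ-≤)
open import Data.Nat.Divisibility using (divides; ∣-trans; m≤n⇒m!∣n!)
open import Algebra.Properties.Semiring.Sum +-*-semiring
  using (sum; sum-syntax; sum-cong-≗; ∑-distrib-+; ∑-comm; sum-remove; *-distribˡ-sum; *-distribʳ-sum)
open import Algebra.Properties.CommutativeSemigroup +-commutativeSemigroup using (interchange)
open import Data.Bool using (Bool; true; false; not; _∨_; _xor_; if_then_else_)
open import Data.Bool.Properties using (not-¬; not-involutive; ∨-zeroʳ; not-distribˡ-xor; not-distribʳ-xor)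
open import Data.Bool.ListAction using (any)
open import Data.Fin using (Fin; zero; suc; punchIn; punchOut; fromℕ; _≟_)
open import Data.Fin.Properties using (punchIn-punchOut; punchInᵢ≢i)
open import Data.Vec using (Vec; []; _∷_; _∷ʳ_; lookup; insertAt)
open import Data.Vec.Properties using (insertAt-lookup; insertAt-punchIn)
open import Data.Vec.Functional using (updateAt)
open import Data.Vec.Functional.Properties using (updateAt-updates; updateAt-minimal)
open import Data.List using (List; []; _∷_; length)
open import Data.List.Membership.Propositional using (_∈_)
open import Data.List.Relation.Unary.Any using (here; there)
open import Data.List.Relation.Unary.All as All using (All; []; _∷_)
open import Data.Product using (Σ; _×_; _,_; proj₁)
open import Data.Sum as Sum using (_⊎_; inj₁; inj₂)
open import Data.Empty using (⊥-elim)
open import Relation.Nullary using (¬_; yes; no; does)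
open import Relation.Nullary.Decidable using (dec-true; dec-false)
open import Relation.Binary.PropositionalEquality

-- Finite sums

∑-mono-≤ : ∀ {n} {f g : Fin n → ℕ} → (∀ i → f i ≤ g i) → ∑[ i < n ] f i ≤ ∑[ i < n ] g i
∑-mono-≤ {zero} f≤g = z≤n
∑-mono-≤ {suc n} f≤g = +-mono-≤ (f≤g zero) (∑-mono-≤ (λ i → f≤g (suc i)))

∑-const : ∀ n c → ∑[ i < n ] c ≡ n * c
∑-const zero c = refl
∑-const (suc n) c = cong (c +_) (∑-const n c)

cubeSum : ∀ n → (Vec Bool n → ℕ) → ℕ
cubeSum zero f = f []
cubeSum (suc n) f = cubeSum n (λ x → f (false ∷ x)) + cubeSum n (λ x → f (true ∷ x))

cubeSum-syntax : ∀ n → (Vec Bool n → ℕ) → ℕ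
cubeSum-syntax = cubeSum

infixl 10 cubeSum-syntax
syntax cubeSum-syntax n (λ x → e) = ∑[ x ∈𝔹^ n ] e

cubeSum-cong : ∀ n {f g : Vec Bool n → ℕ} → (∀ x → f x ≡ g x) → cubeSum n f ≡ cubeSum n g
cubeSum-cong zero f≗g = f≗g []
cubeSum-cong (suc n) f≗g = cong₂ _+_ (cubeSum-cong n (λ x → f≗g _)) (cubeSum-cong n (λ x → f≗g _))

cubeSum-mono-≤ : ∀ n {f g : Vec Bool n → ℕ} → (∀ x → f x ≤ g x) → cubeSum n f ≤ cubeSum n g
cubeSum-mono-≤ zero f≤g = f≤g []
cubeSum-mono-≤ (suc n) f≤g = +-mono-≤ (cubeSum-mono-≤ n (λ x → f≤g _)) (cubeSum-mono-≤ n (λ x → f≤g _))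

cubeSum-distrib-+ : ∀ n (f g : Vec Bool n → ℕ) →
  ∑[ x ∈𝔹^ n ] (f x + g x) ≡ ∑[ x ∈𝔹^ n ] f x + ∑[ x ∈𝔹^ n ] g x
cubeSum-distrib-+ zero f g = refl
cubeSum-distrib-+ (suc n) f g = begin
    cubeSum n (λ x → f (false ∷ x) + g (false ∷ x)) + cubeSum n (λ x → f (true ∷ x) + g (true ∷ x))
  ≡⟨ cong₂ _+_ (cubeSum-distrib-+ n _ _) (cubeSum-distrib-+ n _ _) ⟩
    (cubeSum n (λ x → f (false ∷ x)) + cubeSum n (λ x → g (false ∷ x)))
      + (cubeSum n (λ x → f (true ∷ x)) + cubeSum n (λ x → g (true ∷ x)))
  ≡⟨ interchange (cubeSum n (λ x → f (false ∷ x))) _ (cubeSum n (λ x → f (true ∷ x))) _ ⟩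
    cubeSum (suc n) f + cubeSum (suc n) g ∎
  where open ≡-Reasoning

*-distribˡ-cubeSum : ∀ n c (f : Vec Bool n → ℕ) → c * cubeSum n f ≡ ∑[ x ∈𝔹^ n ] (c * f x)
*-distribˡ-cubeSum zero c f = refl
*-distribˡ-cubeSum (suc n) c f =
  trans (*-distribˡ-+ c _ _) (cong₂ _+_ (*-distribˡ-cubeSum n c _) (*-distribˡ-cubeSum n c _))

cubeSum-const : ∀ n c → ∑[ x ∈𝔹^ n ] c ≡ 2 ^ n * c
cubeSum-const zero c = sym (+-identityʳ c)
cubeSum-const (suc n) c = begin
    cubeSum n (λ _ → c) + cubeSum n (λ _ → c)
  ≡⟨ cong₂ _+_ (cubeSum-const n c) (cubeSum-const n c) ⟩
    2 ^ n * c + 2 ^ n * c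
  ≡⟨ double (2 ^ n) c ⟩
    2 ^ suc n * c ∎
  where
  open ≡-Reasoning
  double : ∀ a c → a * c + a * c ≡ (2 * a) * c
  double = solve-∀

cubeSum-∑-comm : ∀ n m (f : Vec Bool n → Fin m → ℕ) →
  ∑[ x ∈𝔹^ n ] ∑[ j < m ] f x j ≡ ∑[ j < m ] ∑[ x ∈𝔹^ n ] f x j
cubeSum-∑-comm zero m f = refl
cubeSum-∑-comm (suc n) m f =
  trans (cong₂ _+_ (cubeSum-∑-comm n m _) (cubeSum-∑-comm n m _))
        (sym (∑-distrib-+ (λ j → cubeSum n (λ x → f (false ∷ x) j)) _))

cubeSum-insertAt : ∀ n (j : Fin (suc n)) (f : Vec Bool (suc n) → ℕ) →
  cubeSum (suc n) f ≡ ∑[ x ∈𝔹^ n ] f (insertAt x j false) + ∑[ x ∈𝔹^ n ] f (insertAt x j true)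
cubeSum-insertAt n zero f = refl
cubeSum-insertAt (suc n) (suc j) f =
  trans (cong₂ _+_ (cubeSum-insertAt n j (λ x → f (false ∷ x))) (cubeSum-insertAt n j (λ x → f (true ∷ x))))
        (interchange (cubeSum n (λ x → f (false ∷ insertAt x j false))) _
                     (cubeSum n (λ x → f (true ∷ insertAt x j false))) _)

cubeSum-pos : ∀ n (f : Vec Bool n → ℕ) → 0 < cubeSum n f → Σ (Vec Bool n) λ x → 0 < f x
cubeSum-pos zero f pos = [] , pos
cubeSum-pos (suc n) f pos with cubeSum n (λ x → f (false ∷ x)) in eq
... | suc _ = let x , fx>0 = cubeSum-pos n _ (subst (0 <_) (sym eq) (s≤s z≤n)) in false ∷ x , fx>0
... | zero = let x , fx>0 = cubeSum-pos n _ pos in true ∷ x , fx>0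

-- Forced vertices in random deletion orders

𝟙 : Bool → ℕ
𝟙 true = 1
𝟙 false = 0

𝟙-∨-≤ : ∀ a b → 𝟙 (a ∨ b) ≤ 𝟙 a + 𝟙 b
𝟙-∨-≤ true b = s≤s z≤n
𝟙-∨-≤ false b = ≤-refl

𝟙[_≡0] : ℕ → ℕ
𝟙[ zero ≡0] = 1
𝟙[ suc _ ≡0] = 0

count : ∀ n → (Fin n → Bool) → ℕ
count n p = ∑[ i < n ] 𝟙 (p i)

count≡0⇒false : ∀ n (p : Fin n → Bool) → count n p ≡ 0 → ∀ i → p i ≡ false
count≡0⇒false (suc n) p eq zero with p zero
... | false = refl
count≡0⇒false (suc n) p eq (suc i) with p zero
... | false = count≡0⇒false n (λ i → p (suc i)) eq i

Digraph : ℕ → Set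
Digraph n = Fin n → Fin n → Bool

outdeg : ∀ {n} → Digraph n → Fin n → ℕ
outdeg {n} M i = count n (M i)

delete : ∀ {n} → Fin (suc n) → Digraph (suc n) → Digraph n
delete j M i i′ = M (punchIn j i) (punchIn j i′)

-- Vertices are deleted one at a time, in every possible order; a vertex is forced when none of
-- its out-neighbours is still present as it is deleted.  forcedWeight sums 2 ^ (number of forced
-- vertices) over all n ! orders, forcedCount sums the number of forced vertices.
forcedWeight : ∀ n → Digraph n → ℕ
forcedWeight zero M = 1
forcedWeight (suc n) M = ∑[ j < suc n ] (2 ^ 𝟙[ outdeg M j ≡0] * forcedWeight n (delete j M))

forcedCount : ∀ n → Digraph n → ℕ
forcedCount zero M = 0
forcedCount (suc n) M = ∑[ j < suc n ] (𝟙[ outdeg M j ≡0] * n ! + forcedCount n (delete j M))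

Determining : ∀ n → (Vec Bool n → Bool) → (Vec Bool n → Digraph n) → Set
Determining n S D = ∀ x y i → S x ≡ true → S y ≡ true →
  (∀ j → D x i j ≡ true → lookup y j ≡ lookup x j) → lookup y i ≡ lookup x i

solutionWeight : ∀ n → (Vec Bool n → Bool) → (Vec Bool n → Digraph n) → ℕ
solutionWeight n S D = ∑[ x ∈𝔹^ n ] (if S x then forcedWeight n (D x) else 0)

sink-coordinate-fixed : ∀ {n S D} → Determining n S D → ∀ {x y i} → S x ≡ true → outdeg (D x) i ≡ 0 →
  S y ≡ true → lookup y i ≡ lookup x i
sink-coordinate-fixed {n} {D = D} det {x} {y} {i} Sx sink Sy = det x y i Sx Sy noNeighbour
  where
  noNeighbour : ∀ j → D x i j ≡ true → lookup y j ≡ lookup x j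
  noNeighbour j edge with () ← trans (sym edge) (count≡0⇒false n (D x i) sink j)

Determining-insertAt : ∀ {n S D} → Determining (suc n) S D → ∀ j b →
  Determining n (λ x → S (insertAt x j b)) (λ x → delete j (D (insertAt x j b)))
Determining-insertAt {D = D} det j b x y i Sx Sy agree =
  begin
    lookup y i                       ≡⟨ insertAt-punchIn y j b i ⟨
    lookup (insertAt y j b) (punchIn j i)
                                     ≡⟨ det (insertAt x j b) (insertAt y j b) (punchIn j i) Sx Sy agree′ ⟩
    lookup (insertAt x j b) (punchIn j i)
                                     ≡⟨ insertAt-punchIn x j b i ⟩
    lookup x i                       ∎
  where
  open ≡-Reasoning
  x′ = insertAt x j b
  y′ = insertAt y j b
  agree′ : ∀ j′ → D x′ (punchIn j i) j′ ≡ true → lookup y′ j′ ≡ lookup x′ j′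
  agree′ j′ edge with j ≟ j′
  ... | yes refl = trans (insertAt-lookup y j b) (sym (insertAt-lookup x j b))
  ... | no j≢j′ = begin
      lookup y′ j′                            ≡⟨ cong (lookup y′) (punchIn-punchOut j≢j′) ⟨
      lookup y′ (punchIn j (punchOut j≢j′))   ≡⟨ insertAt-punchIn y j b _ ⟩
      lookup y (punchOut j≢j′)                ≡⟨ agree _ (subst (λ t → D x′ (punchIn j i) t ≡ true)
                                                              (sym (punchIn-punchOut j≢j′)) edge) ⟩
      lookup x (punchOut j≢j′)                ≡⟨ insertAt-punchIn x j b _ ⟨
      lookup x′ (punchIn j (punchOut j≢j′))   ≡⟨ cong (lookup x′) (punchIn-punchOut j≢j′) ⟩
      lookup x′ j′                            ∎

if-distrib-∑ : ∀ {m} s (f : Fin m → ℕ) →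
  (if s then ∑[ j < m ] f j else 0) ≡ ∑[ j < m ] (if s then f j else 0)
if-distrib-∑ true f = refl
if-distrib-∑ {m} false f = sym (trans (∑-const m 0) (*-zeroʳ m))

2^𝟙[≡0]* : ∀ d g → 2 ^ 𝟙[ d ≡0] * g ≡ g + 𝟙[ d ≡0] * g
2^𝟙[≡0]* zero g = cong (g +_) (trans (+-identityʳ g) (sym (+-identityʳ g)))
2^𝟙[≡0]* (suc d) g = trans (+-identityʳ g) (sym (+-identityʳ g))

𝟙[≡0]*-≤ : ∀ d g → 𝟙[ d ≡0] * g ≤ g
𝟙[≡0]*-≤ zero g = ≤-reflexive (+-identityʳ g)
𝟙[≡0]*-≤ (suc d) g = z≤n

exclusive-halves-≤ : ∀ {a e a′ e′ B} → a ≤ B → a′ ≤ B → e ≤ a → e′ ≤ a′ →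
  e ≡ 0 ⊎ a′ ≡ 0 → e′ ≡ 0 ⊎ a ≡ 0 → (a + e) + (a′ + e′) ≤ 2 * B
exclusive-halves-≤ {a} {a′ = a′} {B = B} a≤B a′≤B _ _ (inj₁ refl) (inj₁ refl) = begin
  (a + 0) + (a′ + 0) ≡⟨ cong₂ _+_ (+-identityʳ a) (+-identityʳ a′) ⟩
  a + a′             ≤⟨ +-mono-≤ a≤B a′≤B ⟩
  B + B              ≡⟨ cong (B +_) (+-identityʳ B) ⟨
  2 * B              ∎
  where open ≤-Reasoning
exclusive-halves-≤ {B = B} a≤B a′≤B e≤a e′≤a′ _ (inj₂ refl) =
  ≤-trans (+-mono-≤ e≤a (+-mono-≤ a′≤B (≤-trans e′≤a′ a′≤B)))
          (≤-reflexive (cong (B +_) (sym (+-identityʳ B))))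
exclusive-halves-≤ {B = B} a≤B a′≤B e≤a e′≤a′ (inj₂ refl) _ =
  ≤-trans (+-mono-≤ (+-mono-≤ a≤B (≤-trans e≤a a≤B)) e′≤a′)
          (≤-reflexive (trans (+-identityʳ (B + B)) (cong (B +_) (sym (+-identityʳ B)))))

-- The column of j, split along the coordinate j: a solution's weight doubles exactly when j is forced
-- in it, and then every solution has the same value at j, so the other half carries no weight.
module KraftStep {n} {S : Vec Bool (suc n) → Bool} {D : Vec Bool (suc n) → Digraph (suc n)}
                 (det : Determining (suc n) S D) (j : Fin (suc n)) where

  Sᵇ : Bool → Vec Bool n → Bool
  Sᵇ b x = S (insertAt x j b)

  Dᵇ : Bool → Vec Bool n → Digraph n
  Dᵇ b x = delete j (D (insertAt x j b))

  sinkᵇ : Bool → Vec Bool n → ℕ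
  sinkᵇ b x = 𝟙[ outdeg (D (insertAt x j b)) j ≡0]

  half forcedHalf : Bool → ℕ
  half b = solutionWeight n (Sᵇ b) (Dᵇ b)
  forcedHalf b = ∑[ x ∈𝔹^ n ] (if Sᵇ b x then sinkᵇ b x * forcedWeight n (Dᵇ b x) else 0)

  summand : Vec Bool (suc n) → ℕ
  summand x = if S x then 2 ^ 𝟙[ outdeg (D x) j ≡0] * forcedWeight n (delete j (D x)) else 0

  column : ℕ
  column = ∑[ x ∈𝔹^ suc n ] summand x

  column≡ : column ≡ (half false + forcedHalf false) + (half true + forcedHalf true)
  column≡ = trans (cubeSum-insertAt n j summand) (cong₂ _+_ (split false) (split true))
    where
    split : ∀ b → ∑[ x ∈𝔹^ n ] (if Sᵇ b x then 2 ^ sinkᵇ b x * forcedWeight n (Dᵇ b x) else 0)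
                  ≡ half b + forcedHalf b
    split b = trans (cubeSum-cong n pointwise) (cubeSum-distrib-+ n _ _)
      where
      pointwise : ∀ x → (if Sᵇ b x then 2 ^ sinkᵇ b x * forcedWeight n (Dᵇ b x) else 0)
                      ≡ (if Sᵇ b x then forcedWeight n (Dᵇ b x) else 0)
                        + (if Sᵇ b x then sinkᵇ b x * forcedWeight n (Dᵇ b x) else 0)
      pointwise x with Sᵇ b x
      ... | true = 2^𝟙[≡0]* (outdeg (D (insertAt x j b)) j) (forcedWeight n (Dᵇ b x))
      ... | false = refl

  forcedHalf≤half : ∀ b → forcedHalf b ≤ half b
  forcedHalf≤half b = cubeSum-mono-≤ n pointwise
    where
    pointwise : ∀ x → (if Sᵇ b x then sinkᵇ b x * forcedWeight n (Dᵇ b x) else 0)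
                    ≤ (if Sᵇ b x then forcedWeight n (Dᵇ b x) else 0)
    pointwise x with Sᵇ b x
    ... | true = 𝟙[≡0]*-≤ (outdeg (D (insertAt x j b)) j) (forcedWeight n (Dᵇ b x))
    ... | false = z≤n

  forcedHalf≡0⊎half≡0 : ∀ b → forcedHalf b ≡ 0 ⊎ half (not b) ≡ 0
  forcedHalf≡0⊎half≡0 b with forcedHalf b in eq
  ... | zero = inj₁ refl
  ... | suc _ with cubeSum-pos n _ (subst (0 <_) (sym eq) (s≤s z≤n))
  ... | x , pos = inj₂ (trans (cubeSum-cong n noSolution) (trans (cubeSum-const n 0) (*-zeroʳ (2 ^ n))))
    where
    solution-with-sink : 0 < (if Sᵇ b x then sinkᵇ b x * forcedWeight n (Dᵇ b x) else 0) →
                         Sᵇ b x ≡ true × outdeg (D (insertAt x j b)) j ≡ 0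
    solution-with-sink pos with Sᵇ b x | outdeg (D (insertAt x j b)) j
    ... | true | zero = refl , refl
    noSolution : ∀ y → (if Sᵇ (not b) y then forcedWeight n (Dᵇ (not b) y) else 0) ≡ 0
    noSolution y with Sᵇ (not b) y in Sy
    ... | false = refl
    ... | true =
      let Sx , sink = solution-with-sink pos
          same = sink-coordinate-fixed det Sx sink Sy
      in ⊥-elim (not-¬ refl (sym (trans (sym (insertAt-lookup y j (not b)))
                                   (trans same (insertAt-lookup x j b)))))

solutionWeight≤ : ∀ n S D → Determining n S D → solutionWeight n S D ≤ n ! * 2 ^ n
solutionWeight≤ zero S D _ with S []
... | true = ≤-refl
... | false = z≤n
solutionWeight≤ (suc n) S D det = begin
    solutionWeight (suc n) S D
  ≡⟨ cubeSum-cong (suc n) (λ x →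
       if-distrib-∑ (S x) (λ j → 2 ^ 𝟙[ outdeg (D x) j ≡0] * forcedWeight n (delete j (D x)))) ⟩
    ∑[ x ∈𝔹^ suc n ] ∑[ j < suc n ] KraftStep.summand det j x
  ≡⟨ cubeSum-∑-comm (suc n) (suc n) (λ x j → KraftStep.summand det j x) ⟩
    ∑[ j < suc n ] KraftStep.column det j
  ≤⟨ ∑-mono-≤ column≤ ⟩
    ∑[ j < suc n ] (2 * (n ! * 2 ^ n))
  ≡⟨ ∑-const (suc n) _ ⟩
    suc n * (2 * (n ! * 2 ^ n))
  ≡⟨ reassociate (suc n) (n !) (2 ^ n) ⟩
    suc n ! * 2 ^ suc n ∎
  where
  open ≤-Reasoning
  reassociate : ∀ a b c → a * (2 * (b * c)) ≡ (a * b) * (2 * c)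
  reassociate = solve-∀
  column≤ : ∀ j → KraftStep.column det j ≤ 2 * (n ! * 2 ^ n)
  column≤ j = begin
      column
    ≡⟨ column≡ ⟩
      (half false + forcedHalf false) + (half true + forcedHalf true)
    ≤⟨ exclusive-halves-≤ (halfBound false) (halfBound true) (forcedHalf≤half false) (forcedHalf≤half true)
                          (forcedHalf≡0⊎half≡0 false) (forcedHalf≡0⊎half≡0 true) ⟩
      2 * (n ! * 2 ^ n) ∎
    where
    open KraftStep det j
    halfBound : ∀ b → half b ≤ n ! * 2 ^ n
    halfBound b = solutionWeight≤ n (Sᵇ b) (Dᵇ b) (Determining-insertAt det j b)

n<2^n : ∀ n → n < 2 ^ n
n<2^n zero = s≤s z≤n
n<2^n (suc n) =
  ≤-trans (+-mono-≤ (m^n>0 2 n) (n<2^n n)) (≤-reflexive (cong (2 ^ n +_) (sym (+-identityʳ (2 ^ n)))))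

-- 2 ^ m * (1 + (c − m)) ≤ 2 ^ c, the tangent line of 2 ^ t at t = m, with the subtraction moved across.
2^-tangent : ∀ c m → 2 ^ m * (1 + c) ≤ 2 ^ c + m * 2 ^ m
2^-tangent c m with m ≤? c
... | yes m≤c = subst (λ c → 2 ^ m * (1 + c) ≤ 2 ^ c + m * 2 ^ m) (m+[n∸m]≡n m≤c) (above (c ∸ m))
  where
  open ≤-Reasoning
  split : ∀ a m d → a * (1 + (m + d)) ≡ a * (1 + d) + m * a
  split = solve-∀
  above : ∀ d → 2 ^ m * (1 + (m + d)) ≤ 2 ^ (m + d) + m * 2 ^ m
  above d = begin
      2 ^ m * (1 + (m + d))       ≡⟨ split (2 ^ m) m d ⟩
      2 ^ m * (1 + d) + m * 2 ^ m ≤⟨ +-monoˡ-≤ (m * 2 ^ m) (*-monoʳ-≤ (2 ^ m) (n<2^n d)) ⟩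
      2 ^ m * 2 ^ d + m * 2 ^ m   ≡⟨ cong (_+ m * 2 ^ m) (^-distribˡ-+-* 2 m d) ⟨
      2 ^ (m + d) + m * 2 ^ m     ∎
... | no m≰c = begin
    2 ^ m * (1 + c)    ≡⟨ *-comm (2 ^ m) (1 + c) ⟩
    (1 + c) * 2 ^ m    ≤⟨ *-monoˡ-≤ (2 ^ m) (≰⇒> m≰c) ⟩
    m * 2 ^ m          ≤⟨ m≤n+m (m * 2 ^ m) (2 ^ c) ⟩
    2 ^ c + m * 2 ^ m  ∎
  where open ≤-Reasoning

-- Summed over deletion orders, this is 2^-tangent at t = c + (number of forced vertices).
forcedWeight-tangent : ∀ m n M c →
  2 ^ m * (n ! + c * n ! + forcedCount n M) ≤ 2 ^ c * forcedWeight n M + n ! * m * 2 ^ m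
forcedWeight-tangent m zero M c =
  subst₂ _≤_ (cong (2 ^ m *_) (shape c))
             (cong₂ _+_ (sym (*-identityʳ (2 ^ c))) (cong (_* 2 ^ m) (sym (*-identityˡ m))))
             (2^-tangent c m)
  where
  shape : ∀ c → 1 + c ≡ 1 + c * 1 + 0
  shape = solve-∀
forcedWeight-tangent m (suc n) M c = begin
    2 ^ m * (suc n ! + c * suc n ! + ∑[ j < N ] (e j * n ! + H j))
  ≡⟨ cong (2 ^ m *_) regroup ⟩
    2 ^ m * ∑[ j < N ] (n ! + (c + e j) * n ! + H j)
  ≡⟨ *-distribˡ-sum (2 ^ m) (λ j → n ! + (c + e j) * n ! + H j) ⟩
    ∑[ j < N ] (2 ^ m * (n ! + (c + e j) * n ! + H j))
  ≤⟨ ∑-mono-≤ (λ j → forcedWeight-tangent m n (delete j M) (c + e j)) ⟩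
    ∑[ j < N ] (2 ^ (c + e j) * G j + n ! * m * 2 ^ m)
  ≡⟨ ∑-distrib-+ (λ j → 2 ^ (c + e j) * G j) (λ _ → n ! * m * 2 ^ m) ⟩
    ∑[ j < N ] (2 ^ (c + e j) * G j) + ∑[ j < N ] (n ! * m * 2 ^ m)
  ≡⟨ cong₂ _+_ factor-2^c (trans (∑-const N _) (factorial-step n (n !) m (2 ^ m))) ⟩
    2 ^ c * ∑[ j < N ] (2 ^ e j * G j) + suc n ! * m * 2 ^ m ∎
  where
  open ≤-Reasoning
  N = suc n
  e G H : Fin N → ℕ
  e j = 𝟙[ outdeg M j ≡0]
  G j = forcedWeight n (delete j M)
  H j = forcedCount n (delete j M)
  factorial-step : ∀ n f m a → suc n * (f * m * a) ≡ (f + n * f) * m * a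
  factorial-step = solve-∀
  split : ∀ f c e h → f + (c + e) * f + h ≡ (f + c * f) + (e * f + h)
  split = solve-∀
  collect : ∀ n f c → suc n * (f + c * f) ≡ (f + n * f) + c * (f + n * f)
  collect = solve-∀
  regroup : suc n ! + c * suc n ! + ∑[ j < N ] (e j * n ! + H j) ≡ ∑[ j < N ] (n ! + (c + e j) * n ! + H j)
  regroup = sym (begin-equality
      ∑[ j < N ] (n ! + (c + e j) * n ! + H j)
    ≡⟨ sum-cong-≗ (λ j → split (n !) c (e j) (H j)) ⟩
      ∑[ j < N ] ((n ! + c * n !) + (e j * n ! + H j))
    ≡⟨ ∑-distrib-+ (λ _ → n ! + c * n !) (λ j → e j * n ! + H j) ⟩
      ∑[ j < N ] (n ! + c * n !) + ∑[ j < N ] (e j * n ! + H j)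
    ≡⟨ cong (_+ ∑[ j < N ] (e j * n ! + H j)) (trans (∑-const N _) (collect n (n !) c)) ⟩
      suc n ! + c * suc n ! + ∑[ j < N ] (e j * n ! + H j) ∎)
  factor-2^c : ∑[ j < N ] (2 ^ (c + e j) * G j) ≡ 2 ^ c * ∑[ j < N ] (2 ^ e j * G j)
  factor-2^c = begin-equality
      ∑[ j < N ] (2 ^ (c + e j) * G j)
    ≡⟨ sum-cong-≗ (λ j → trans (cong (_* G j) (^-distribˡ-+-* 2 c (e j)))
                               (*-assoc (2 ^ c) (2 ^ e j) (G j))) ⟩
      ∑[ j < N ] (2 ^ c * (2 ^ e j * G j))
    ≡⟨ *-distribˡ-sum (2 ^ c) (λ j → 2 ^ e j * G j) ⟨
      2 ^ c * ∑[ j < N ] (2 ^ e j * G j) ∎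

count-remove : ∀ n (p : Fin (suc n) → Bool) j → 𝟙 (p j) + count n (λ t → p (punchIn j t)) ≡ count (suc n) p
count-remove n p j = sym (sum-remove (λ i → 𝟙 (p i)))

count-remove-≤ : ∀ n (p : Fin (suc n) → Bool) j → count n (λ t → p (punchIn j t)) ≤ count (suc n) p
count-remove-≤ n p j = ≤-trans (m≤n+m _ (𝟙 (p j))) (≤-reflexive (count-remove n p j))

∑-via-count : ∀ N (p : Fin N → Bool) (h : Bool → ℕ) →
  ∑[ j < N ] h (p j) + count N p * h false ≡ count N p * h true + N * h false
∑-via-count zero p h = refl
∑-via-count (suc N) p h with p zero | ∑-via-count N (λ j → p (suc j)) h
... | true | ih = trans (shuffle (h true) (h false) (∑[ j < N ] h (p (suc j))) c)
                        (trans (cong (h true + h false +_) ih) (collect (h true) (h false) c N))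
  where
  c = count N (λ j → p (suc j))
  shuffle : ∀ t f s c → t + s + (1 + c) * f ≡ t + f + (s + c * f)
  shuffle = solve-∀
  collect : ∀ t f c N → t + f + (c * t + N * f) ≡ (1 + c) * t + suc N * f
  collect = solve-∀
... | false | ih = trans (+-assoc (h false) _ (c * h false))
                         (trans (cong (h false +_) ih) (collect (h true) (h false) c N))
  where
  c = count N (λ j → p (suc j))
  collect : ∀ t f c N → f + (c * t + N * f) ≡ c * t + suc N * f
  collect = solve-∀

module OutdegreeBelow (k′ : ℕ) where

  k : ℕ
  k = suc k′

  -- k ! times the probability 1 / (d + 1) that a vertex is deleted after all of its d out-neighbours.
  weight : ℕ → ℕ
  weight d = k ! / suc d

  weight-exact : ∀ d → suc d ≤ k → suc d * weight d ≡ k !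
  weight-exact d d<k = m*[n/m]≡n (∣-trans (divides (d !) (*-comm (suc d) (d !))) (m≤n⇒m!∣n! d<k))

  weight-recurrence : ∀ c → c < k → suc c * weight c ≡ 𝟙[ c ≡0] * k ! + c * weight (c ∸ 1)
  weight-recurrence zero _ = cong (_+ 0) (trans (n/1≡n (k !)) (sym (+-identityʳ (k !))))
  weight-recurrence (suc c) c<k = trans (weight-exact (suc c) c<k) (sym (weight-exact c (<⇒≤ c<k)))

  weight-row : ∀ n (p : Fin (suc n) → Bool) i → p i ≡ false → count (suc n) p < k →
    suc n * weight (count (suc n) p) + weight (count n (λ t → p (punchIn i t)))
      ≡ 𝟙[ count (suc n) p ≡0] * k ! + ∑[ j < suc n ] weight (count n (λ t → p (punchIn j t)))
  weight-row n p i pᵢ≡false c<k = +-cancelʳ-≡ (c * weight c) _ _ (begin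
      (N * weight c + weight cᵢ) + c * weight c
    ≡⟨ cong (λ d → N * weight c + weight d + c * weight c) cᵢ≡c ⟩
      (N * weight c + weight c) + c * weight c
    ≡⟨ regroup (N * weight c) (weight c) (c * weight c) ⟩
      N * weight c + suc c * weight c
    ≡⟨ cong (N * weight c +_) (weight-recurrence c c<k) ⟩
      N * weight c + (𝟙[ c ≡0] * k ! + c * weight (c ∸ 1))
    ≡⟨ swap (N * weight c) (𝟙[ c ≡0] * k !) (c * weight (c ∸ 1)) ⟩
      𝟙[ c ≡0] * k ! + (c * weight (c ∸ 1) + N * weight c)
    ≡⟨ cong (𝟙[ c ≡0] * k ! +_) (∑-via-count N p h) ⟨
      𝟙[ c ≡0] * k ! + (∑[ j < N ] h (p j) + c * weight c)
    ≡⟨ cong (λ s → 𝟙[ c ≡0] * k ! + (s + c * weight c))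
            (sum-cong-≗ (λ j → cong weight (sym (removed j)))) ⟩
      𝟙[ c ≡0] * k ! + (∑[ j < N ] weight (count n (λ t → p (punchIn j t))) + c * weight c)
    ≡⟨ +-assoc (𝟙[ c ≡0] * k !) _ (c * weight c) ⟨
      (𝟙[ c ≡0] * k ! + ∑[ j < N ] weight (count n (λ t → p (punchIn j t)))) + c * weight c ∎)
    where
    open ≡-Reasoning
    N = suc n
    c = count N p
    cᵢ = count n (λ t → p (punchIn i t))
    h : Bool → ℕ
    h b = weight (c ∸ 𝟙 b)
    removed : ∀ j → count n (λ t → p (punchIn j t)) ≡ c ∸ 𝟙 (p j)
    removed j = trans (sym (m+n∸m≡n (𝟙 (p j)) _)) (cong (_∸ 𝟙 (p j)) (count-remove n p j))
    cᵢ≡c : cᵢ ≡ c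
    cᵢ≡c = trans (removed i) (cong (λ b → c ∸ 𝟙 b) pᵢ≡false)
    regroup : ∀ a w b → a + w + b ≡ a + (w + b)
    regroup = solve-∀
    swap : ∀ a b d → a + (b + d) ≡ b + (d + a)
    swap = solve-∀

  ∑-weight-delete : ∀ n (M : Digraph (suc n)) → (∀ i → M i i ≡ false) → (∀ i → outdeg M i < k) →
    suc n * ∑[ i < suc n ] weight (outdeg M i)
      ≡ ∑[ j < suc n ] (𝟙[ outdeg M j ≡0] * k ! + ∑[ i < n ] weight (outdeg (delete j M) i))
  ∑-weight-delete n M irrefl bounded = +-cancelˡ-≡ (∑[ i < N ] W i i) _ _ (begin
      ∑[ i < N ] W i i + N * ∑[ i < N ] weight (outdeg M i)
    ≡⟨ cong (∑[ i < N ] W i i +_) (*-distribˡ-sum N (λ i → weight (outdeg M i))) ⟩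
      ∑[ i < N ] W i i + ∑[ i < N ] (N * weight (outdeg M i))
    ≡⟨ +-comm (∑[ i < N ] W i i) _ ⟩
      ∑[ i < N ] (N * weight (outdeg M i)) + ∑[ i < N ] W i i
    ≡⟨ ∑-distrib-+ (λ i → N * weight (outdeg M i)) (λ i → W i i) ⟨
      ∑[ i < N ] (N * weight (outdeg M i) + W i i)
    ≡⟨ sum-cong-≗ (λ i → weight-row n (M i) i (irrefl i) (bounded i)) ⟩
      ∑[ i < N ] (F i + ∑[ j < N ] W j i)
    ≡⟨ ∑-distrib-+ F (λ i → ∑[ j < N ] W j i) ⟩
      ∑[ j < N ] F j + ∑[ i < N ] ∑[ j < N ] W j i
    ≡⟨ cong (∑[ j < N ] F j +_) (∑-comm (λ i j → W j i)) ⟩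
      ∑[ j < N ] F j + ∑[ j < N ] ∑[ i < N ] W j i
    ≡⟨ ∑-distrib-+ F (λ j → ∑[ i < N ] W j i) ⟨
      ∑[ j < N ] (F j + ∑[ i < N ] W j i)
    ≡⟨ sum-cong-≗ (λ j → cong (F j +_) (sum-remove {i = j} (W j))) ⟩
      ∑[ j < N ] (F j + (W j j + R j))
    ≡⟨ sum-cong-≗ (λ j → +-comm-middle (F j) (W j j) (R j)) ⟩
      ∑[ j < N ] (W j j + (F j + R j))
    ≡⟨ ∑-distrib-+ (λ j → W j j) (λ j → F j + R j) ⟩
      ∑[ i < N ] W i i + ∑[ j < N ] (F j + R j) ∎)
    where
    open ≡-Reasoning
    N = suc n
    W : Fin N → Fin N → ℕ
    W j i = weight (count n (λ t → M i (punchIn j t)))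
    F R : Fin N → ℕ
    F j = 𝟙[ outdeg M j ≡0] * k !
    R j = ∑[ i < n ] weight (outdeg (delete j M) i)
    +-comm-middle : ∀ a b c → a + (b + c) ≡ b + (a + c)
    +-comm-middle = solve-∀

  forcedCount-exact : ∀ n (M : Digraph n) → (∀ i → M i i ≡ false) → (∀ i → outdeg M i < k) →
    n ! * ∑[ i < n ] weight (outdeg M i) ≡ forcedCount n M * k !
  forcedCount-exact zero M _ _ = refl
  forcedCount-exact (suc n) M irrefl bounded = begin
      suc n ! * ∑[ i < suc n ] weight (outdeg M i)
    ≡⟨ unfold-! n (n !) (∑[ i < suc n ] weight (outdeg M i)) ⟩
      n ! * (suc n * ∑[ i < suc n ] weight (outdeg M i))
    ≡⟨ cong (n ! *_) (∑-weight-delete n M irrefl bounded) ⟩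
      n ! * ∑[ j < suc n ] (e j * k ! + R j)
    ≡⟨ *-distribˡ-sum (n !) (λ j → e j * k ! + R j) ⟩
      ∑[ j < suc n ] (n ! * (e j * k ! + R j))
    ≡⟨ sum-cong-≗ (λ j → expand (n !) (e j) (k !) (R j)) ⟩
      ∑[ j < suc n ] (e j * n ! * k ! + n ! * R j)
    ≡⟨ sum-cong-≗ (λ j → cong (e j * n ! * k ! +_)
                              (forcedCount-exact n (delete j M) (λ i → irrefl (punchIn j i)) (bounded′ j))) ⟩
      ∑[ j < suc n ] (e j * n ! * k ! + forcedCount n (delete j M) * k !)
    ≡⟨ sum-cong-≗ (λ j → *-distribʳ-+ (k !) (e j * n !) (forcedCount n (delete j M))) ⟨
      ∑[ j < suc n ] ((e j * n ! + forcedCount n (delete j M)) * k !)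
    ≡⟨ *-distribʳ-sum (k !) (λ j → e j * n ! + forcedCount n (delete j M)) ⟨
      forcedCount (suc n) M * k ! ∎
    where
    open ≡-Reasoning
    e R : Fin (suc n) → ℕ
    e j = 𝟙[ outdeg M j ≡0]
    R j = ∑[ i < n ] weight (outdeg (delete j M) i)
    bounded′ : ∀ j i → outdeg (delete j M) i < k
    bounded′ j i = ≤-<-trans (count-remove-≤ n (M (punchIn j i)) j) (bounded (punchIn j i))
    unfold-! : ∀ n f s → (f + n * f) * s ≡ f * (suc n * s)
    unfold-! = solve-∀
    expand : ∀ f e g r → f * (e * g + r) ≡ e * f * g + f * r
    expand = solve-∀

  weight-pos : 0 < weight k′
  weight-pos with weight k′ | weight-exact k′ ≤-refl
  ... | zero | k*0≡k! =
    ⊥-elim (<-irrefl refl (≤-trans (1≤n! k) (≤-reflexive (trans (sym k*0≡k!) (*-zeroʳ k′)))))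
  ... | suc _ | _ = s≤s z≤n

  forcedCount-lower : ∀ {n m} (M : Digraph n) → (∀ i → M i i ≡ false) → (∀ i → outdeg M i < k) →
    n ≡ k * m → n ! * m ≤ forcedCount n M
  forcedCount-lower {n} {m} M irrefl bounded n≡km =
    *-cancelʳ-≤ (n ! * m) (forcedCount n M) k (*-cancelʳ-≤ _ _ (weight k′) {{>-nonZero weight-pos}} (begin
      n ! * m * k * weight k′
    ≡⟨ reorder (n !) m k (weight k′) ⟩
      n ! * ((k * m) * weight k′)
    ≡⟨ cong (λ t → n ! * (t * weight k′)) n≡km ⟨
      n ! * (n * weight k′)
    ≡⟨ cong (n ! *_) (∑-const n (weight k′)) ⟨
      n ! * ∑[ i < n ] weight k′
    ≤⟨ *-monoʳ-≤ (n !) (∑-mono-≤ (λ i → /-monoʳ-≤ (k !) (bounded i))) ⟩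
      n ! * ∑[ i < n ] weight (outdeg M i)
    ≡⟨ forcedCount-exact n M irrefl bounded ⟩
      forcedCount n M * k !
    ≡⟨ cong (forcedCount n M *_) (weight-exact k′ ≤-refl) ⟨
      forcedCount n M * (k * weight k′)
    ≡⟨ *-assoc (forcedCount n M) k (weight k′) ⟨
      forcedCount n M * k * weight k′ ∎))
    where
    open ≤-Reasoning
    reorder : ∀ f m k w → f * m * k * w ≡ f * ((k * m) * w)
    reorder = solve-∀

  forcedWeight-lower : ∀ {n m} (M : Digraph n) → (∀ i → M i i ≡ false) → (∀ i → outdeg M i < k) →
    n ≡ k * m → n ! * 2 ^ m ≤ forcedWeight n M
  forcedWeight-lower {n} {m} M irrefl bounded n≡km =
    +-cancelʳ-≤ (n ! * m * 2 ^ m) (n ! * 2 ^ m) (forcedWeight n M) (begin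
      n ! * 2 ^ m + n ! * m * 2 ^ m
    ≡⟨ factor (n !) m (2 ^ m) ⟩
      2 ^ m * (n ! + 0 * n ! + n ! * m)
    ≤⟨ *-monoʳ-≤ (2 ^ m) (+-monoʳ-≤ (n ! + 0) (forcedCount-lower M irrefl bounded n≡km)) ⟩
      2 ^ m * (n ! + 0 * n ! + forcedCount n M)
    ≤⟨ forcedWeight-tangent m n M 0 ⟩
      1 * forcedWeight n M + n ! * m * 2 ^ m
    ≡⟨ cong (_+ n ! * m * 2 ^ m) (*-identityˡ (forcedWeight n M)) ⟩
      forcedWeight n M + n ! * m * 2 ^ m ∎)
    where
    open ≤-Reasoning
    factor : ∀ f m a → f * a + f * m * a ≡ a * (f + 0 * f + f * m)
    factor = solve-∀

  solutions≤ : ∀ {n m S D} → Determining n S D →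
    (∀ x → S x ≡ true → (∀ i → D x i i ≡ false) × (∀ i → outdeg (D x) i < k)) →
    n ≡ k * m → ∑[ x ∈𝔹^ n ] 𝟙 (S x) * 2 ^ m ≤ 2 ^ n
  solutions≤ {n} {m} {S} {D} det sparse n≡km = *-cancelˡ-≤ (n !) {{>-nonZero (1≤n! n)}} (begin
      n ! * (∑[ x ∈𝔹^ n ] 𝟙 (S x) * 2 ^ m)
    ≡⟨ reorder (n !) (∑[ x ∈𝔹^ n ] 𝟙 (S x)) (2 ^ m) ⟩
      n ! * 2 ^ m * ∑[ x ∈𝔹^ n ] 𝟙 (S x)
    ≡⟨ *-distribˡ-cubeSum n (n ! * 2 ^ m) (λ x → 𝟙 (S x)) ⟩
      ∑[ x ∈𝔹^ n ] (n ! * 2 ^ m * 𝟙 (S x))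
    ≤⟨ cubeSum-mono-≤ n pointwise ⟩
      solutionWeight n S D
    ≤⟨ solutionWeight≤ n S D det ⟩
      n ! * 2 ^ n ∎)
    where
    open ≤-Reasoning
    reorder : ∀ a b c → a * (b * c) ≡ a * c * b
    reorder = solve-∀
    pointwise : ∀ x → n ! * 2 ^ m * 𝟙 (S x) ≤ (if S x then forcedWeight n (D x) else 0)
    pointwise x with S x in Sx
    ... | false = ≤-reflexive (*-zeroʳ (n ! * 2 ^ m))
    ... | true = let irrefl , bounded = sparse x Sx in
      ≤-trans (≤-reflexive (*-identityʳ (n ! * 2 ^ m))) (forcedWeight-lower (D x) irrefl bounded n≡km)

-- Critical clauses

flipAt : ∀ {n} → Fin n → Input n → Input n
flipAt i x = updateAt x i not

removeVar : ∀ {n} → Fin n → Clause n → Clause n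
removeVar i [] = []
removeVar i ((j , b) ∷ c) = if does (j ≟ i) then removeVar i c else (j , b) ∷ removeVar i c

mentions : ∀ {n} → Clause n → Fin n → Bool
mentions c j = any (λ l → does (proj₁ l ≟ j)) c

∨-≡true : ∀ a {b} → a ∨ b ≡ true → a ≡ true ⊎ b ≡ true
∨-≡true true _ = inj₁ refl
∨-≡true false b≡true = inj₂ b≡true

∨-≡false : ∀ a {b} → a ∨ b ≡ false → a ≡ false × b ≡ false
∨-≡false false b≡false = refl , b≡false

mentions-removeVar-self : ∀ {n} (i : Fin n) c → mentions (removeVar i c) i ≡ false
mentions-removeVar-self i [] = refl
mentions-removeVar-self i ((j , b) ∷ c) with j ≟ i
... | yes _ = mentions-removeVar-self i c
... | no j≢i rewrite dec-false (j ≟ i) j≢i = mentions-removeVar-self i c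

mentions-∷-self : ∀ {n} (j : Fin n) b c → mentions ((j , b) ∷ c) j ≡ true
mentions-∷-self j b c = cong (_∨ mentions c j) (dec-true (j ≟ j) refl)

mentions-removeVar-tail : ∀ {n} (i : Fin n) l c {j} → mentions (removeVar i c) j ≡ true →
  mentions (removeVar i (l ∷ c)) j ≡ true
mentions-removeVar-tail i (j′ , b) c m with j′ ≟ i
... | yes _ = m
... | no _ = trans (cong (_ ∨_) m) (∨-zeroʳ _)

count-≟ : ∀ n (j : Fin n) → count n (λ i → does (j ≟ i)) ≡ 1
count-≟ (suc n) j = begin
    count (suc n) (λ i → does (j ≟ i))
  ≡⟨ sum-remove {i = j} (λ i → 𝟙 (does (j ≟ i))) ⟩
    𝟙 (does (j ≟ j)) + count n (λ t → does (j ≟ punchIn j t))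
  ≡⟨ cong₂ _+_ (cong 𝟙 (dec-true (j ≟ j) refl)) (sum-cong-≗ others) ⟩
    1 + ∑[ t < n ] 0
  ≡⟨ cong suc (trans (∑-const n 0) (*-zeroʳ n)) ⟩
    1 ∎
  where
  open ≡-Reasoning
  others : ∀ t → 𝟙 (does (j ≟ punchIn j t)) ≡ 0
  others t = cong 𝟙 (dec-false (j ≟ punchIn j t) (λ j≡ → punchInᵢ≢i j t (sym j≡)))

count-mentions≤length : ∀ n (c : Clause n) → count n (mentions c) ≤ length c
count-mentions≤length n [] = ≤-reflexive (trans (∑-const n 0) (*-zeroʳ n))
count-mentions≤length n ((j , b) ∷ c) = begin
    count n (λ i → does (j ≟ i) ∨ mentions c i)
  ≤⟨ ∑-mono-≤ (λ i → 𝟙-∨-≤ (does (j ≟ i)) (mentions c i)) ⟩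
    ∑[ i < n ] (𝟙 (does (j ≟ i)) + 𝟙 (mentions c i))
  ≡⟨ ∑-distrib-+ (λ i → 𝟙 (does (j ≟ i))) (λ i → 𝟙 (mentions c i)) ⟩
    count n (λ i → does (j ≟ i)) + count n (mentions c)
  ≤⟨ +-mono-≤ (≤-reflexive (count-≟ n j)) (count-mentions≤length n c) ⟩
    suc (length c) ∎
  where open ≤-Reasoning

length-removeVar-≤ : ∀ {n} (i : Fin n) c → length (removeVar i c) ≤ length c
length-removeVar-≤ i [] = z≤n
length-removeVar-≤ i ((j , b) ∷ c) with j ≟ i
... | yes _ = m≤n⇒m≤1+n (length-removeVar-≤ i c)
... | no _ = s≤s (length-removeVar-≤ i c)

evalLit-cong : ∀ {n} {x y : Input n} j b → y j ≡ x j → evalLit y (j , b) ≡ evalLit x (j , b)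
evalLit-cong j true yj≡xj = yj≡xj
evalLit-cong j false yj≡xj = cong not yj≡xj

evalLit-flipAt-≢ : ∀ {n} (x : Input n) {i j} b → j ≢ i → evalLit (flipAt i x) (j , b) ≡ evalLit x (j , b)
evalLit-flipAt-≢ x {i} {j} b j≢i = evalLit-cong j b (updateAt-minimal j i x j≢i)

evalLit-flipAt-self : ∀ {n} (x y : Input n) i b →
  evalLit y (i , b) ≡ true → evalLit (flipAt i x) (i , b) ≡ false →
  y i ≡ x i
evalLit-flipAt-self x y i b ylit x′lit =
  trans (literal b ylit x′lit) (trans (cong not (updateAt-updates i x)) (not-involutive (x i)))
  where
  literal : ∀ b → evalLit y (i , b) ≡ true → evalLit (flipAt i x) (i , b) ≡ false → y i ≡ not (flipAt i x i)
  literal true yᵢ x′ᵢ = trans yᵢ (sym (cong not x′ᵢ))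
  literal false yᵢ x′ᵢ = trans (sym (not-involutive (y i))) (trans (cong not yᵢ) (sym x′ᵢ))

-- A clause that is true at x but false once x is flipped at i must contain a literal on i.
length-removeVar-< : ∀ {n} (x : Input n) i c → evalClause x c ≡ true → evalClause (flipAt i x) c ≡ false →
  length (removeVar i c) < length c
length-removeVar-< x i ((j , b) ∷ c) xc x′c with j ≟ i
... | yes _ = s≤s (length-removeVar-≤ i c)
... | no j≢i with ∨-≡true (evalLit x (j , b)) xc | ∨-≡false (evalLit (flipAt i x) (j , b)) x′c
...   | inj₁ xlit | x′lit , _ =
  ⊥-elim (not-¬ refl (trans (sym xlit) (trans (sym (evalLit-flipAt-≢ x b j≢i)) x′lit)))
...   | inj₂ xc′ | _ , x′c′ = s≤s (length-removeVar-< x i c xc′ x′c′)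

-- Every literal of c other than those on i is false at x, so a solution y of c that agrees with x
-- off i can only satisfy c through its literal on i.
critical-clause-determines : ∀ {n} (x y : Input n) i c →
  evalClause y c ≡ true → evalClause (flipAt i x) c ≡ false →
  (∀ j → mentions (removeVar i c) j ≡ true → y j ≡ x j) → y i ≡ x i
critical-clause-determines x y i ((j , b) ∷ c) yc x′c agree
  with ∨-≡true (evalLit y (j , b)) yc | ∨-≡false (evalLit (flipAt i x) (j , b)) x′c
... | inj₂ yc′ | _ , x′c′ =
  critical-clause-determines x y i c yc′ x′c′ (λ j′ m → agree j′ (mentions-removeVar-tail i (j , b) c m))
... | inj₁ ylit | x′lit , _ with j ≟ i
...   | yes refl = evalLit-flipAt-self x y j b ylit x′lit
...   | no j≢i = ⊥-elim (not-¬ refl (begin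
        true                         ≡⟨ ylit ⟨
        evalLit y (j , b)            ≡⟨ evalLit-cong j b (agree j (mentions-∷-self j b (removeVar i c))) ⟩
        evalLit x (j , b)            ≡⟨ evalLit-flipAt-≢ x b j≢i ⟨
        evalLit (flipAt i x) (j , b) ≡⟨ x′lit ⟩
        false                        ∎))
  where open ≡-Reasoning

firstFalsified : ∀ {n} → Input n → CNF n → Clause n
firstFalsified y [] = []
firstFalsified y (c ∷ F) = if evalClause y c then firstFalsified y F else c

firstFalsified-spec : ∀ {n} (y : Input n) F → evalCNF y F ≡ false →
  firstFalsified y F ∈ F × evalClause y (firstFalsified y F) ≡ false
firstFalsified-spec y (c ∷ F) yF with evalClause y c in yc
... | true = let c∈F , yc′ = firstFalsified-spec y F yF in there c∈F , yc′
... | false = here refl , yc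

evalCNF-∈ : ∀ {n} (y : Input n) F {c} → evalCNF y F ≡ true → c ∈ F → evalClause y c ≡ true
evalCNF-∈ y (c ∷ F) yF (here refl) with evalClause y c
... | true = refl
evalCNF-∈ y (c′ ∷ F) yF (there c∈F) with evalClause y c′
... | true = evalCNF-∈ y F yF c∈F

Isolated : ∀ {n} → CNF n → Set
Isolated {n} F = ∀ (x : Input n) i → evalCNF x F ≡ true → evalCNF (flipAt i x) F ≡ false

-- For a solution x, the critical clause of i is a clause falsified by flipping x at i; the value
-- of a solution at i is then determined by its values on the other variables of that clause.
criticalClause : ∀ {n} → CNF n → Input n → Fin n → Clause n
criticalClause F x i = firstFalsified (flipAt i x) F

criticalGraph : ∀ {n} → CNF n → Vec Bool n → Digraph n
criticalGraph F x i = mentions (removeVar i (criticalClause F (lookup x) i))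

module _ {n} {F : CNF n} (isolated : Isolated F) where

  criticalClause-spec : ∀ x i → evalCNF x F ≡ true →
    criticalClause F x i ∈ F × evalClause (flipAt i x) (criticalClause F x i) ≡ false
  criticalClause-spec x i xF = firstFalsified-spec (flipAt i x) F (isolated x i xF)

  criticalGraph-determining : Determining n (λ x → evalCNF (lookup x) F) (criticalGraph F)
  criticalGraph-determining x y i xF yF =
    let c∈F , x′c = criticalClause-spec (lookup x) i xF in
    critical-clause-determines (lookup x) (lookup y) i (criticalClause F (lookup x) i)
                               (evalCNF-∈ (lookup y) F yF c∈F) x′c

  criticalGraph-sparse : ∀ k → IsKCNF k F → ∀ x → evalCNF (lookup x) F ≡ true →
    (∀ i → criticalGraph F x i i ≡ false) × (∀ i → outdeg (criticalGraph F x) i < k)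
  criticalGraph-sparse k kF x xF = (λ i → mentions-removeVar-self i (c i)) , bounded
    where
    c : Fin n → Clause n
    c = criticalClause F (lookup x)
    bounded : ∀ i → outdeg (criticalGraph F x) i < k
    bounded i =
      let c∈F , x′c = criticalClause-spec (lookup x) i xF in
      ≤-<-trans (count-mentions≤length n (removeVar i (c i)))
        (<-≤-trans (length-removeVar-< (lookup x) i (c i) (evalCNF-∈ (lookup x) F xF c∈F) x′c)
                   (All.lookup kF c∈F))

isolated-solutions≤ : ∀ {k′ n m} {F : CNF n} → Isolated F → IsKCNF (suc k′) F → n ≡ suc k′ * m →
  ∑[ x ∈𝔹^ n ] 𝟙 (evalCNF (lookup x) F) * 2 ^ m ≤ 2 ^ n
isolated-solutions≤ {k′} {F = F} isolated kF n≡km =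
  OutdegreeBelow.solutions≤ k′ (criticalGraph-determining {F = F} isolated)
    (criticalGraph-sparse {F = F} isolated (suc k′) kF) n≡km

union-solutions≤ : ∀ {k′ n m} (Φ : List (CNF n)) → All Isolated Φ → All (IsKCNF (suc k′)) Φ →
  n ≡ suc k′ * m →
  ∑[ x ∈𝔹^ n ] 𝟙 (evalOrCNF (lookup x) Φ) * 2 ^ m ≤ length Φ * 2 ^ n
union-solutions≤ {n = n} {m} [] [] [] _ =
  ≤-reflexive (cong (_* 2 ^ m) (trans (cubeSum-const n 0) (*-zeroʳ (2 ^ n))))
union-solutions≤ {n = n} {m} (F ∷ Φ) (isoF ∷ isoΦ) (kF ∷ kΦ) n≡km = begin
    ∑[ x ∈𝔹^ n ] 𝟙 (sat F x ∨ evalOrCNF (lookup x) Φ) * 2 ^ m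
  ≤⟨ *-monoˡ-≤ (2 ^ m) (cubeSum-mono-≤ n (λ x → 𝟙-∨-≤ (sat F x) (evalOrCNF (lookup x) Φ))) ⟩
    ∑[ x ∈𝔹^ n ] (𝟙 (sat F x) + 𝟙 (evalOrCNF (lookup x) Φ)) * 2 ^ m
  ≡⟨ cong (_* 2 ^ m) (cubeSum-distrib-+ n (λ x → 𝟙 (sat F x)) (λ x → 𝟙 (evalOrCNF (lookup x) Φ))) ⟩
    (∑[ x ∈𝔹^ n ] 𝟙 (sat F x) + ∑[ x ∈𝔹^ n ] 𝟙 (evalOrCNF (lookup x) Φ)) * 2 ^ m
  ≡⟨ *-distribʳ-+ (2 ^ m) (∑[ x ∈𝔹^ n ] 𝟙 (sat F x)) _ ⟩
    ∑[ x ∈𝔹^ n ] 𝟙 (sat F x) * 2 ^ m + ∑[ x ∈𝔹^ n ] 𝟙 (evalOrCNF (lookup x) Φ) * 2 ^ m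
  ≤⟨ +-mono-≤ (isolated-solutions≤ isoF kF n≡km) (union-solutions≤ Φ isoΦ kΦ n≡km) ⟩
    2 ^ n + length Φ * 2 ^ n ∎
  where
  open ≤-Reasoning
  sat : CNF n → Vec Bool n → Bool
  sat F x = evalCNF (lookup x) F

-- Parity

parity : ∀ n → Input n → Bool
parity zero x = false
parity (suc n) x = parity n (λ i → x (suc i)) xor x zero

parity-flipAt : ∀ n (x : Input n) i → parity n (flipAt i x) ≡ not (parity n x)
parity-flipAt (suc n) x zero = sym (not-distribʳ-xor (parity n (λ i → x (suc i))) (x zero))
parity-flipAt (suc n) x (suc i) =
  trans (cong (_xor x zero) (parity-flipAt n (λ j → x (suc j)) i))
        (sym (not-distribˡ-xor (parity n (λ j → x (suc j))) (x zero)))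

odd-count : ∀ n → ∑[ x ∈𝔹^ suc n ] 𝟙 (parity (suc n) (lookup x)) ≡ 2 ^ n
odd-count n = begin
    ∑[ x ∈𝔹^ n ] 𝟙 (parity n (lookup x) xor false) + ∑[ x ∈𝔹^ n ] 𝟙 (parity n (lookup x) xor true)
  ≡⟨ cubeSum-distrib-+ n (λ x → 𝟙 (parity n (lookup x) xor false))
                         (λ x → 𝟙 (parity n (lookup x) xor true)) ⟨
    ∑[ x ∈𝔹^ n ] (𝟙 (parity n (lookup x) xor false) + 𝟙 (parity n (lookup x) xor true))
  ≡⟨ cubeSum-cong n (λ x → one-of-two (parity n (lookup x))) ⟩
    ∑[ x ∈𝔹^ n ] 1
  ≡⟨ trans (cubeSum-const n 1) (*-identityʳ (2 ^ n)) ⟩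
    2 ^ n ∎
  where
  open ≡-Reasoning
  one-of-two : ∀ b → 𝟙 (b xor false) + 𝟙 (b xor true) ≡ 1
  one-of-two true = refl
  one-of-two false = refl

below-parity⇒isolated : ∀ {n} (F : CNF n) → (∀ x → evalCNF x F ≡ true → parity n x ≡ true) → Isolated F
below-parity⇒isolated {n} F below x i xF with evalCNF (flipAt i x) F in x′F
... | false = refl
... | true = ⊥-elim (not-¬ refl (begin
    true                      ≡⟨ below (flipAt i x) x′F ⟨
    parity n (flipAt i x)     ≡⟨ parity-flipAt n x i ⟩
    not (parity n x)          ≡⟨ cong not (below x xF) ⟩
    false                     ∎))
  where open ≡-Reasoning

below-parity⇒all-isolated : ∀ {n} (Φ : List (CNF n)) → (∀ x → evalOrCNF x Φ ≡ true → parity n x ≡ true) →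
  All Isolated Φ
below-parity⇒all-isolated [] _ = []
below-parity⇒all-isolated (F ∷ Φ) below =
  below-parity⇒isolated F (λ x xF → below x (cong (_∨ evalOrCNF x Φ) xF))
  ∷ below-parity⇒all-isolated Φ (λ x xΦ → below x (trans (cong (evalCNF x F ∨_) xΦ) (∨-zeroʳ _)))

shiftInputs : ∀ {n s} → Circuit n s → Circuit (suc n) s
shiftInputs [] = []
shiftInputs (C ▷ (a , b , f)) = shiftInputs C ▷ (Sum.map₁ suc a , Sum.map₁ suc b , f)

shiftInputs-gateValues : ∀ {n s} (C : Circuit n s) x →
  gateValues (shiftInputs C) x ≡ gateValues C (λ i → x (suc i))
shiftInputs-gateValues [] x = refl
shiftInputs-gateValues (C ▷ (inj₁ i , inj₁ j , f)) x rewrite shiftInputs-gateValues C x = refl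
shiftInputs-gateValues (C ▷ (inj₁ i , inj₂ j , f)) x rewrite shiftInputs-gateValues C x = refl
shiftInputs-gateValues (C ▷ (inj₂ i , inj₁ j , f)) x rewrite shiftInputs-gateValues C x = refl
shiftInputs-gateValues (C ▷ (inj₂ i , inj₂ j , f)) x rewrite shiftInputs-gateValues C x = refl

lookup-∷ʳ-last : ∀ {s} (v : Vec Bool s) b → lookup (v ∷ʳ b) (fromℕ s) ≡ b
lookup-∷ʳ-last [] b = refl
lookup-∷ʳ-last (a ∷ v) b = lookup-∷ʳ-last v b

parityCircuit : ∀ r → Circuit (suc (suc r)) (suc r)
parityCircuit zero = [] ▷ (inj₁ (suc zero) , inj₁ zero , _xor_)
parityCircuit (suc r) = shiftInputs (parityCircuit r) ▷ (inj₂ (fromℕ r) , inj₁ zero , _xor_)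

parityCircuit-computes : ∀ r x → computes (parityCircuit r) (fromℕ r) x ≡ parity (suc (suc r)) x
parityCircuit-computes zero x = refl
parityCircuit-computes (suc r) x = begin
    lookup (v ∷ʳ (lookup v (fromℕ r) xor x zero)) (fromℕ (suc r))
  ≡⟨ lookup-∷ʳ-last v (lookup v (fromℕ r) xor x zero) ⟩
    lookup v (fromℕ r) xor x zero
  ≡⟨ cong (λ w → lookup w (fromℕ r) xor x zero) (shiftInputs-gateValues (parityCircuit r) x) ⟩
    computes (parityCircuit r) (fromℕ r) (λ i → x (suc i)) xor x zero
  ≡⟨ cong (_xor x zero) (parityCircuit-computes r (λ i → x (suc i))) ⟩
    parity (suc (suc (suc r))) x ∎
  where
  open ≡-Reasoning
  v = gateValues (shiftInputs (parityCircuit r)) x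

parity-cover-size : ∀ {k′ q r} → suc r ≡ suc k′ * suc q →
  (Φ : List (CNF (suc r))) → All (IsKCNF (suc k′)) Φ →
  (∀ x → parity (suc r) x ≡ evalOrCNF x Φ) → 2 ^ q ≤ length Φ
parity-cover-size {q = q} {r} n≡km Φ kΦ covers =
  *-cancelʳ-≤ (2 ^ q) (length Φ) (2 ^ suc r) {{>-nonZero (m^n>0 2 (suc r))}} (begin
    2 ^ q * 2 ^ suc r
  ≡⟨ swap-doubling (2 ^ q) (2 ^ r) ⟩
    2 ^ r * 2 ^ suc q
  ≡⟨ cong (_* 2 ^ suc q) (odd-count r) ⟨
    ∑[ x ∈𝔹^ suc r ] 𝟙 (parity (suc r) (lookup x)) * 2 ^ suc q
  ≡⟨ cong (_* 2 ^ suc q) (cubeSum-cong (suc r) (λ x → cong 𝟙 (covers (lookup x)))) ⟩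
    ∑[ x ∈𝔹^ suc r ] 𝟙 (evalOrCNF (lookup x) Φ) * 2 ^ suc q
  ≤⟨ union-solutions≤ Φ (below-parity⇒all-isolated Φ (λ x xΦ → trans (covers x) xΦ)) kΦ n≡km ⟩
    length Φ * 2 ^ suc r ∎)
  where
  open ≤-Reasoning
  swap-doubling : ∀ a b → a * (2 * b) ≡ b * (2 * a)
  swap-doubling = solve-∀

exponent-gap : ∀ k p q s → k * p < q → s ≤ k * suc q → p * s < q * q
exponent-gap k p q s kp<q s≤ = begin-strict
    p * s              ≤⟨ *-monoʳ-≤ p s≤ ⟩
    p * (k * suc q)    ≡⟨ reassociate p k (suc q) ⟩
    k * p * suc q      ≡⟨ *-suc (k * p) q ⟩
    k * p + k * p * q  <⟨ +-monoˡ-< (k * p * q) kp<q ⟩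
    q + k * p * q      ≡⟨⟩
    suc (k * p) * q    ≤⟨ *-monoˡ-≤ q kp<q ⟩
    q * q              ∎
  where
  open ≤-Reasoning
  reassociate : ∀ p k m → p * (k * m) ≡ k * p * m
  reassociate = solve-∀

lemma3 : ∀ (k : ℕ) → 2 ≤ k → ∀ (p q : ℕ) → 0 < q → k * p < q → ¬ Admissible k p q
lemma3 k@(suc (suc k″)) (s≤s (s≤s z≤n)) p q _ kp<q admissible =
  let Φ , size , kΦ , computes≡ = admissible n (suc r) (parityCircuit r) (fromℕ r)
      covers x = trans (sym (parityCircuit-computes r x)) (computes≡ x)
  in <-irrefl refl (begin-strict
    2 ^ (q * q)       ≡⟨ ^-*-assoc 2 q q ⟨
    (2 ^ q) ^ q       ≤⟨ ^-monoˡ-≤ q (parity-cover-size n≡km Φ kΦ covers) ⟩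
    length Φ ^ q      ≤⟨ size ⟩
    2 ^ (p * suc r)   <⟨ ^-monoʳ-< 2 (s≤s (s≤s z≤n)) (exponent-gap k p q (suc r) kp<q size≤n) ⟩
    2 ^ (q * q)       ∎)
  where
  open ≤-Reasoning
  r = q + (q + k″ * suc q)
  n = suc (suc r)
  n≡km : n ≡ k * suc q
  n≡km = cong suc (sym (+-suc q (q + k″ * suc q)))
  size≤n : suc r ≤ k * suc q
  size≤n = ≤-trans (n≤1+n (suc r)) (≤-reflexive n≡km)
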